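{- Let $s_1,s_2,s_3\ge 3$ be integers. Then $$R(K_{2s_1-1}^{(3)}-e,\ K_{2s_2-1}^{(3)},\ K_{2s_3-1}^{(3)};3)\ \ge\ R(K_{s_1},K_{s_2},K_{s_3};2).$$
   Context: $K_m^{(r)}$ denotes the complete $r$-uniform hypergraph on $m$ vertices ($K_m=K_m^{(2)}$), and $K_m^{(3)}-e$ denotes $K_m^{(3)}$ with one hyperedge removed. For $r$-uniform hypergraphs $H_1,\dots,H_t$, the Ramsey number $R(H_1,\dots,H_t;r)$ is the least positive integer $p$ such that every coloring of the hyperedges of $K_p^{(r)}$ with colors $1,\dots,t$ contains, for some $i$, a subhypergraph isomorphic to $H_i$ all of whose hyperedges have color $i$. -}

module Defs where

open import Data.Nat using (ℕ; _≤_; _∸_; _*_)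
open import Data.Fin using (Fin; zero; suc)
open import Data.Sum using (_⊎_)
open import Data.Fin.Subset using (Subset; ∣_∣; _⊆_)
open import Data.Product using (Σ; Σ-syntax; ∃-syntax; _×_; proj₁)
open import Relation.Binary.PropositionalEquality using (_≡_; _≢_)

-- Hyperedges of the complete r-uniform hypergraph K_p^(r) on vertex set Fin p:
-- the r-element subsets of Fin p.
Edge : ℕ → ℕ → Set
Edge p r = Σ[ e ∈ Subset p ] ∣ e ∣ ≡ r

Coloring : ℕ → ℕ → ℕ → Set
Coloring p r t = Edge p r → Fin t

MonoClique : ∀ {p r t} → Coloring p r t → Fin t → ℕ → Set
MonoClique {p} {r} c i m =
  ∃[ S ] (∣ S ∣ ≡ m × ((e : Edge p r) → proj₁ e ⊆ S → c e ≡ i))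

MonoCliqueMinusEdge : ∀ {p r t} → Coloring p r t → Fin t → ℕ → Set
MonoCliqueMinusEdge {p} {r} c i m =
  ∃[ S ] (∣ S ∣ ≡ m × Σ[ f ∈ Edge p r ] (proj₁ f ⊆ S ×
     ((e : Edge p r) → proj₁ e ⊆ S → proj₁ e ≢ proj₁ f → c e ≡ i)))

IsLeastPositive : (ℕ → Set) → ℕ → Set
IsLeastPositive P p = 1 ≤ p × P p × ((q : ℕ) → 1 ≤ q → P q → p ≤ q)

Arrows2 : ℕ → ℕ → ℕ → ℕ → Set
Arrows2 a b d p = (c : Coloring p 2 3) →
  MonoClique c zero a ⊎ (MonoClique c (suc zero) b ⊎ MonoClique c (suc (suc zero)) d)

Arrows3 : ℕ → ℕ → ℕ → ℕ → Set
Arrows3 a b d p = (c : Coloring p 3 3) →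
  MonoCliqueMinusEdge c zero a ⊎ (MonoClique c (suc zero) b ⊎ MonoClique c (suc (suc zero)) d)

IsR2 : ℕ → ℕ → ℕ → ℕ → Set
IsR2 a b d = IsLeastPositive (Arrows2 a b d)

IsR3 : ℕ → ℕ → ℕ → ℕ → Set
IsR3 a b d = IsLeastPositive (Arrows3 a b d)

{-# OPTIONS --safe #-}
-- Colour each triple {a < b < c} by the colour of the pair {b, c}.  If a
-- set S of 2s - 1 vertices is monochromatic for this colouring up to one
-- missing triple f, remove the two least vertices a₁ < a₂ of S: every pair
-- of the remaining 2s - 3 ≥ s vertices extends to the two triples through a₁
-- and through a₂, at least one of which differs from f and so carries the
-- colour of the pair.  Hence a colouring of K_p avoiding the three cliques
-- yields a colouring of K_p^(3) avoiding the three hypergraphs.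
module Submission where

open import Defs
open import Data.Nat using (ℕ; _≤_; _∸_; _*_; zero; suc; z≤n; s≤s)
open import Data.Nat.Properties using (≡-irrelevant; m≤n+m; +-identityʳ)
open import Data.Bool using (true; false)
open import Data.Bool.Properties using () renaming (_≟_ to _≟ᵇ_)
open import Data.Vec using (_∷_; []; here; tail)
open import Data.Vec.Properties using (≡-dec)
open import Data.Fin.Subset using (Subset; ∣_∣; _⊆_; ⊥)
open import Data.Fin.Subset.Properties using (out⊆; in⊆in; drop-∷-⊆; ⊥⊆; ∣⊥∣≡0; ⊆-trans; ⊆-refl)
open import Data.Sum using (inj₁; inj₂)
open import Data.Product using (∃-syntax; _×_; proj₁; _,_)
open import Relation.Binary.PropositionalEquality using (_≡_; _≢_; refl; sym; trans; cong; subst)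
open import Relation.Nullary using (yes; no; ¬_)
open import Data.Empty using (⊥-elim)

deleteMin : ∀ {n} → Subset n → Subset n
deleteMin []          = []
deleteMin (true ∷ s)  = false ∷ s
deleteMin (false ∷ s) = false ∷ deleteMin s

∣deleteMin∣ : ∀ {n} (s : Subset n) → ∣ deleteMin s ∣ ≡ ∣ s ∣ ∸ 1
∣deleteMin∣ []          = refl
∣deleteMin∣ (true ∷ s)  = refl
∣deleteMin∣ (false ∷ s) = ∣deleteMin∣ s

deleteMin-⊆ : ∀ {n} (s : Subset n) → deleteMin s ⊆ s
deleteMin-⊆ []          = ⊆-refl
deleteMin-⊆ (true ∷ s)  = out⊆ ⊆-refl
deleteMin-⊆ (false ∷ s) = out⊆ (deleteMin-⊆ s)

true∷⊈false∷ : ∀ {n} {s t : Subset n} → ¬ (true ∷ s ⊆ false ∷ t)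
true∷⊈false∷ s⊆t with s⊆t here
... | ()

⊆-ofSize : ∀ {n} m (S : Subset n) → m ≤ ∣ S ∣ → ∃[ T ] (T ⊆ S × ∣ T ∣ ≡ m)
⊆-ofSize {n} zero S _ = ⊥ , ⊥⊆ , ∣⊥∣≡0 n
⊆-ofSize (suc m) (false ∷ S) m≤∣S∣ with ⊆-ofSize (suc m) S m≤∣S∣
... | T , T⊆S , ∣T∣ = false ∷ T , out⊆ T⊆S , ∣T∣
⊆-ofSize (suc m) (true ∷ S) (s≤s m≤∣S∣) with ⊆-ofSize m S m≤∣S∣
... | T , T⊆S , ∣T∣ = true ∷ T , in⊆in T⊆S , cong suc ∣T∣

-- e is g with one vertex of S below all of g added.
IsMinExtension : ∀ {n} → Subset n → Subset n → Subset n → Set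
IsMinExtension S g e = e ⊆ S × ∣ e ∣ ≡ suc ∣ g ∣ × deleteMin e ≡ g

minExtension : ∀ {n} (S g : Subset n) → g ⊆ deleteMin S → 1 ≤ ∣ S ∣ →
  ∃[ e ] IsMinExtension S g e
minExtension (false ∷ S) (true ∷ g)  g⊆ _ = ⊥-elim (true∷⊈false∷ g⊆)
minExtension (true ∷ S)  (true ∷ g)  g⊆ _ = ⊥-elim (true∷⊈false∷ g⊆)
minExtension (true ∷ S)  (false ∷ g) g⊆ _ = true ∷ g , in⊆in (drop-∷-⊆ g⊆) , refl , refl
minExtension (false ∷ S) (false ∷ g) g⊆ 1≤∣S∣ with minExtension S g (drop-∷-⊆ g⊆) 1≤∣S∣
... | e , e⊆S , ∣e∣ , e↦g = false ∷ e , out⊆ e⊆S , ∣e∣ , cong (false ∷_) e↦g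

twoMinExtensions : ∀ {n} (S g : Subset n) → g ⊆ deleteMin (deleteMin S) → 2 ≤ ∣ S ∣ →
  ∃[ e₁ ] ∃[ e₂ ] (IsMinExtension S g e₁ × IsMinExtension S g e₂ × e₁ ≢ e₂)
twoMinExtensions (false ∷ S) (true ∷ g)  g⊆ _ = ⊥-elim (true∷⊈false∷ g⊆)
twoMinExtensions (true ∷ S)  (true ∷ g)  g⊆ _ = ⊥-elim (true∷⊈false∷ g⊆)
twoMinExtensions (true ∷ S)  (false ∷ g) g⊆ (s≤s 1≤∣S∣)
  with minExtension S g (drop-∷-⊆ g⊆) 1≤∣S∣
... | e , e⊆S , ∣e∣ , e↦g =
  true ∷ g , false ∷ e ,
  (in⊆in (⊆-trans (drop-∷-⊆ g⊆) (deleteMin-⊆ S)) , refl , refl) ,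
  (out⊆ e⊆S , ∣e∣ , cong (false ∷_) e↦g) ,
  λ ()
twoMinExtensions (false ∷ S) (false ∷ g) g⊆ 2≤∣S∣
  with twoMinExtensions S g (drop-∷-⊆ g⊆) 2≤∣S∣
... | e₁ , e₂ , (e₁⊆S , ∣e₁∣ , e₁↦g) , (e₂⊆S , ∣e₂∣ , e₂↦g) , e₁≢e₂ =
  false ∷ e₁ , false ∷ e₂ ,
  (out⊆ e₁⊆S , ∣e₁∣ , cong (false ∷_) e₁↦g) ,
  (out⊆ e₂⊆S , ∣e₂∣ , cong (false ∷_) e₂↦g) ,
  λ eq → e₁≢e₂ (cong tail eq)

s≤2*s∸3 : ∀ s → 3 ≤ s → s ≤ 2 * s ∸ 1 ∸ 1 ∸ 1
s≤2*s∸3 (suc (suc (suc k))) (s≤s (s≤s (s≤s _))) rewrite +-identityʳ k = m≤n+m (suc (suc (suc k))) k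

2≤2*s∸1 : ∀ s → 3 ≤ s → 2 ≤ 2 * s ∸ 1
2≤2*s∸1 (suc (suc (suc _))) (s≤s (s≤s (s≤s _))) = s≤s (s≤s z≤n)

Edge-≡ : ∀ {p r} {e f : Edge p r} → proj₁ e ≡ proj₁ f → e ≡ f
Edge-≡ {e = e , ∣e∣} {f = .e , ∣f∣} refl = cong (e ,_) (≡-irrelevant ∣e∣ ∣f∣)

module _ {p r t} (c : Coloring p r t) where

  liftMin : Coloring p (suc r) t
  liftMin (e , ∣e∣) = c (deleteMin e , trans (∣deleteMin∣ e) (cong (_∸ 1) ∣e∣))

  monoClique-⊆ : ∀ {i m} (U : Subset p) → m ≤ ∣ U ∣ →
    ((g : Edge p r) → proj₁ g ⊆ U → c g ≡ i) → MonoClique c i m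
  monoClique-⊆ {m = m} U m≤∣U∣ mono with ⊆-ofSize m U m≤∣U∣
  ... | T , T⊆U , ∣T∣ = T , ∣T∣ , λ g g⊆T → mono g (⊆-trans g⊆T T⊆U)

  liftMin-monoExcept⇒mono : ∀ {i} (S F : Subset p) → 2 ≤ ∣ S ∣ →
    ((e : Edge p (suc r)) → proj₁ e ⊆ S → proj₁ e ≢ F → liftMin e ≡ i) →
    (g : Edge p r) → proj₁ g ⊆ deleteMin (deleteMin S) → c g ≡ i
  liftMin-monoExcept⇒mono {i} S F 2≤∣S∣ mono (g , ∣g∣) g⊆
    with twoMinExtensions S g g⊆ 2≤∣S∣
  ... | e₁ , e₂ , ext₁ , ext₂ , e₁≢e₂ = colour extensionAvoidingF
    where
    extensionAvoidingF : ∃[ e ] (IsMinExtension S g e × e ≢ F)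
    extensionAvoidingF with ≡-dec _≟ᵇ_ e₁ F
    ... | yes e₁≡F = e₂ , ext₂ , λ e₂≡F → e₁≢e₂ (trans e₁≡F (sym e₂≡F))
    ... | no e₁≢F  = e₁ , ext₁ , e₁≢F

    colour : ∃[ e ] (IsMinExtension S g e × e ≢ F) → c (g , ∣g∣) ≡ i
    colour (e , (e⊆S , ∣e∣ , e↦g) , e≢F) =
      trans (cong c (Edge-≡ (sym e↦g))) (mono (e , trans ∣e∣ (cong suc ∣g∣)) e⊆S e≢F)

  liftMin-monoExcept⇒monoClique : ∀ {i s} → 3 ≤ s → (S F : Subset p) → ∣ S ∣ ≡ 2 * s ∸ 1 →
    ((e : Edge p (suc r)) → proj₁ e ⊆ S → proj₁ e ≢ F → liftMin e ≡ i) →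
    MonoClique c i s
  liftMin-monoExcept⇒monoClique {s = s} 3≤s S F ∣S∣ mono =
    monoClique-⊆ (deleteMin (deleteMin S)) s≤∣S∣∸2
      (liftMin-monoExcept⇒mono S F (subst (2 ≤_) (sym ∣S∣) (2≤2*s∸1 s 3≤s)) mono)
    where
    s≤∣S∣∸2 : s ≤ ∣ deleteMin (deleteMin S) ∣
    s≤∣S∣∸2 rewrite ∣deleteMin∣ (deleteMin S) | ∣deleteMin∣ S | ∣S∣ = s≤2*s∸3 s 3≤s

arrows3⇒arrows2 : ∀ {s₁ s₂ s₃ p} → 3 ≤ s₁ → 3 ≤ s₂ → 3 ≤ s₃ →
  Arrows3 (2 * s₁ ∸ 1) (2 * s₂ ∸ 1) (2 * s₃ ∸ 1) p → Arrows2 s₁ s₂ s₃ p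
arrows3⇒arrows2 3≤s₁ 3≤s₂ 3≤s₃ arrows c with arrows (liftMin c)
... | inj₁ (S , ∣S∣ , f , _ , mono) =
  inj₁ (liftMin-monoExcept⇒monoClique c 3≤s₁ S (proj₁ f) ∣S∣ mono)
... | inj₂ (inj₁ (S , ∣S∣ , mono)) =
  inj₂ (inj₁ (liftMin-monoExcept⇒monoClique c 3≤s₂ S S ∣S∣ λ e e⊆S _ → mono e e⊆S))
... | inj₂ (inj₂ (S , ∣S∣ , mono)) =
  inj₂ (inj₂ (liftMin-monoExcept⇒monoClique c 3≤s₃ S S ∣S∣ λ e e⊆S _ → mono e e⊆S))

theorem12 : (s₁ s₂ s₃ : ℕ) → 3 ≤ s₁ → 3 ≤ s₂ → 3 ≤ s₃ →
    (p q : ℕ) → IsR3 (2 * s₁ ∸ 1) (2 * s₂ ∸ 1) (2 * s₃ ∸ 1) p →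
    IsR2 s₁ s₂ s₃ q → q ≤ p
theorem12 s₁ s₂ s₃ 3≤s₁ 3≤s₂ 3≤s₃ p q (1≤p , p-arrows3 , _) (_ , _ , q-least) =
  q-least p 1≤p (arrows3⇒arrows2 3≤s₁ 3≤s₂ 3≤s₃ p-arrows3)
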